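{- Let $L$ be a finite join-semidistributive lattice with canonical join complex $\Delta$, and let $\Theta$ be a lattice congruence of $L$. Then the canonical join complex of the lattice $\pi_\downarrow^\Theta(L)$ is the induced subcomplex of $\Delta$ on the set of join-irreducible elements of $L$ that are not contracted by $\Theta$.
   Context: A lattice congruence $\Theta$ on $L$ is an equivalence relation such that $x\equiv_\Theta y$ implies $x\vee t\equiv_\Theta y\vee t$ and $x\wedge t\equiv_\Theta y\wedge t$ for all $t$. For finite $L$ each congruence class is an interval; $\pi_\downarrow^\Theta$ sends $x$ to the smallest element of its class, and its image $\pi_\downarrow^\Theta(L)$, with the order induced from $L$, is a lattice (isomorphic to the quotient $L/\Theta$). A join-irreducible $j$ (covering exactly one element $j_*$) is contracted by $\Theta$ if $j\equiv_\Theta j_*$. A join $\bigvee A$ is irredundant if no proper subset has the same join; the canonical join representation of $w$ is the unique join-refinement-minimal irredundant $A$ with $\bigvee A=w$ ($A$ refines $B$ if each element of $A$ lies below some element of $B$). Join-semidistributive: $x\vee y=x\vee z\Rightarrow x\vee(y\wedge z)=x\vee y$. The canonical join complex has as faces the sets that are the canonical join representation of their join. -}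

module Defs where

open import Level using (0ℓ)
open import Data.Nat using (ℕ)
open import Data.Fin using (Fin)
open import Data.Product using (Σ; ∃; _×_)
open import Relation.Binary.Core using (Rel)
open import Relation.Binary.Structures using (IsEquivalence)
open import Relation.Binary.PropositionalEquality using (_≡_)
open import Relation.Nullary using (¬_)
open import Relation.Unary using (Pred; _∈_; _∉_; _⊆_; U)
open import Algebra.Core using (Op₂)
open import Function.Bundles using (_↔_)

Finite : Set → Set
Finite X = Σ ℕ λ n → X ↔ Fin n

module _ {L : Set} (_≤_ : Rel L 0ℓ) where

  _<_ : Rel L 0ℓ
  x < y = (x ≤ y) × ¬ (x ≡ y)

  _⋖_ : Rel L 0ℓ
  y ⋖ x = (y < x) × (∀ z → y < z → ¬ (z < x))

  IsJoinIrreducibleWithLowerCover : L → L → Set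
  IsJoinIrreducibleWithLowerCover j j* = (j* ⋖ j) × (∀ y → y ⋖ j → y ≡ j*)

  -- Everything below is relative to a subposet P ⊆ L with the induced order.
  module _ (P : Pred L 0ℓ) where

    IsJoinIn : Pred L 0ℓ → L → Set
    IsJoinIn A w = (A ⊆ P) × (w ∈ P) × (∀ {a} → a ∈ A → a ≤ w)
                   × (∀ u → u ∈ P → (∀ {a} → a ∈ A → a ≤ u) → w ≤ u)

    ProperSubset : Pred L 0ℓ → Pred L 0ℓ → Set
    ProperSubset B A = (B ⊆ A) × ∃ λ a → (a ∈ A) × (a ∉ B)

    IrredundantJoin : Pred L 0ℓ → L → Set₁
    IrredundantJoin A w = IsJoinIn A w × (∀ B → ProperSubset B A → ¬ IsJoinIn B w)

    Refines : Pred L 0ℓ → Pred L 0ℓ → Set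
    Refines A B = ∀ {a} → a ∈ A → ∃ λ b → (b ∈ B) × (a ≤ b)

    IsCanonicalJoinRep : Pred L 0ℓ → L → Set₁
    IsCanonicalJoinRep A w = IrredundantJoin A w
                             × (∀ B → IrredundantJoin B w → Refines A B)

    CJCFace : Pred L 0ℓ → Set₁
    CJCFace A = ∃ λ w → IsCanonicalJoinRep A w

JoinSemidistributive : {L : Set} → Op₂ L → Op₂ L → Set
JoinSemidistributive _∨_ _∧_ =
  ∀ x y z → x ∨ y ≡ x ∨ z → x ∨ (y ∧ z) ≡ x ∨ y

record IsLatticeCongruence {L : Set} (_∨_ _∧_ : Op₂ L) (Θ : Rel L 0ℓ) : Set where
  field
    isEquivalence : IsEquivalence Θ
    ∨-compat : ∀ {x y} t → Θ x y → Θ (x ∨ t) (y ∨ t)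
    ∧-compat : ∀ {x y} t → Θ x y → Θ (x ∧ t) (y ∧ t)

module _ {L : Set} (_≤_ : Rel L 0ℓ) (Θ : Rel L 0ℓ) where

  IsPiDown : L → L → Set
  IsPiDown x y = Θ x y × (∀ z → Θ x z → y ≤ z)

  PiDownImage : Pred L 0ℓ
  PiDownImage y = ∃ λ x → IsPiDown x y

  UncontractedJoinIrreducible : Pred L 0ℓ
  UncontractedJoinIrreducible j =
    ∃ λ j* → IsJoinIrreducibleWithLowerCover _≤_ j j* × ¬ Θ j j*

module Submission where

-- The image P = π↓(L) is closed under joins in L, and for subsets of P joins in P and in L
-- agree, since u ≥ ⋁A implies π↓ u ≥ ⋁A; so irredundant joins are the same in both. Elements
-- of a canonical join representation in L are join-irreducible, and a join-irreducible j lies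
-- in P exactly when j ≢Θ j*. Refinement passes from L to P because irredundant joins in P are
-- irredundant in L, and from P to L by replacing a competitor B of w ∈ P with π↓[B], which
-- has the same join.

open import Defs
open import Level using (0ℓ)
open import Data.Product using (_×_; ∃; _,_; proj₁; proj₂)
open import Data.Sum using (_⊎_; inj₁; inj₂)
open import Data.Empty using (⊥-elim)
open import Data.Unit using (tt)
open import Data.Bool.Properties using (T-≡)
open import Data.Fin using (Fin)
open import Data.Fin.Properties using (inj⇒≟)
open import Data.Fin.Subset using (Subset; _⊂_) renaming (_∈_ to _∈ₛ_)
open import Data.Fin.Subset.Induction using (⊂-wellFounded)
open import Data.List using (List; foldr; map; allFin)
open import Data.List.Relation.Unary.Any using (here; there)
open import Data.List.Membership.Propositional using () renaming (_∈_ to _∈ˡ_)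
open import Data.List.Membership.Propositional.Properties using (∈-map⁺; ∈-allFin)
open import Data.Vec using (tabulate)
open import Data.Vec.Properties using (lookup∘tabulate; []=⇒lookup; lookup⇒[]=)
open import Relation.Binary.Core using (Rel)
open import Relation.Binary.Definitions using (Transitive; Irreflexive; Decidable; DecidableEquality)
open import Relation.Binary.Structures using (IsEquivalence)
open import Relation.Binary.PropositionalEquality using (_≡_; _≢_; refl; sym; trans; subst)
open import Relation.Binary.Lattice.Bundles using (Lattice)
import Relation.Binary.Lattice.Structures as LS
import Relation.Binary.Construct.On as On
open import Relation.Unary using (Pred; _⊆_; U; _∈_; _∉_)
open import Relation.Nullary using (¬_; Dec; yes; no)
open import Relation.Nullary.Decidable using (isYes; toWitness; fromWitness; decidable-stable; ¬¬-excluded-middle)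
open import Induction.WellFounded using (WellFounded; Acc; acc; module Subrelation)
open import Axiom.ExcludedMiddle using (ExcludedMiddle)
open import Algebra.Core using (Op₂)
open import Function.Base using (flip)
open import Function.Bundles using (_⇔_; mk⇔; Inverse; Equivalence)
open import Function.Properties.Inverse using (↔⇒↣)

infix 4 _⊊_

_⊊_ : {X : Set} → Rel (Pred X 0ℓ) 0ℓ
B ⊊ A = B ⊆ A × ∃ λ a → a ∈ A × a ∉ B

finite⇒≟ : {X : Set} → Finite X → DecidableEquality X
finite⇒≟ (_ , X↔Fin) = inj⇒≟ (↔⇒↣ X↔Fin)

∃-minimal : ExcludedMiddle 0ℓ → {X : Set} {_<_ : Rel X 0ℓ} → WellFounded _<_
  → (S : Pred X 0ℓ) → ∀ {x} → x ∈ S → ∃ λ m → m ∈ S × (∀ {y} → y ∈ S → ¬ y < m)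
∃-minimal em {_<_ = _<_} wf S {x} x∈S = go (wf x) x∈S
  where
  go : ∀ {x} → Acc _<_ x → x ∈ S → ∃ λ m → m ∈ S × (∀ {y} → y ∈ S → ¬ y < m)
  go {x} (acc rs) x∈S with em {∃ λ y → y ∈ S × y < x}
  ... | yes (y , y∈S , y<x) = go (rs y<x) y∈S
  ... | no ∄y = x , x∈S , λ y∈S y<x → ∄y (_ , y∈S , y<x)

module FiniteClassical {X : Set} (fin : Finite X) (em : ExcludedMiddle 0ℓ) where

  private
    from : Fin (proj₁ fin) → X
    from = Inverse.from (proj₂ fin)

    to : X → Fin (proj₁ fin)
    to = Inverse.to (proj₂ fin)

    from∘to : ∀ x → from (to x) ≡ x
    from∘to = Inverse.strictlyInverseʳ (proj₂ fin)

  toSubset : Pred X 0ℓ → Subset (proj₁ fin)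
  toSubset S = tabulate λ i → isYes (em {S (from i)})

  ∈-toSubset⁺ : ∀ {S i} → from i ∈ S → i ∈ₛ toSubset S
  ∈-toSubset⁺ {i = i} s =
    lookup⇒[]= i _ (trans (lookup∘tabulate _ i) (Equivalence.to T-≡ (fromWitness s)))

  ∈-toSubset⁻ : ∀ {S i} → i ∈ₛ toSubset S → from i ∈ S
  ∈-toSubset⁻ {i = i} i∈ =
    toWitness (Equivalence.from T-≡ (trans (sym (lookup∘tabulate _ i)) ([]=⇒lookup i∈)))

  ⊊⇒⊂ : ∀ {B A} → B ⊊ A → toSubset B ⊂ toSubset A
  ⊊⇒⊂ {B} {A} (B⊆A , a , a∈A , a∉B) =
    (λ i∈B → ∈-toSubset⁺ {A} (B⊆A (∈-toSubset⁻ {B} i∈B))) ,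
    to a , ∈-toSubset⁺ {A} (subst A (sym (from∘to a)) a∈A) ,
    λ i∈B → a∉B (subst B (from∘to a) (∈-toSubset⁻ {B} i∈B))

  ⊊-wellFounded : WellFounded (_⊊_ {X})
  ⊊-wellFounded = Subrelation.wellFounded ⊊⇒⊂ (On.wellFounded toSubset ⊂-wellFounded)

  strict⇒wellFounded : {_<_ : Rel X 0ℓ} → Transitive _<_ → Irreflexive _≡_ _<_ → WellFounded _<_
  strict⇒wellFounded {_<_} <-trans <-irrefl =
    Subrelation.wellFounded ↓-⊊ (On.wellFounded (flip _<_) ⊊-wellFounded)
    where
    ↓-⊊ : ∀ {x y} → x < y → flip _<_ x ⊊ flip _<_ y
    ↓-⊊ x<y = (λ z<x → <-trans z<x x<y) , _ , x<y , <-irrefl refl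

module SubposetJoins {L : Set} (_≤_ : Rel L 0ℓ) (≤-trans : Transitive _≤_)
  (_≟_ : DecidableEquality L) where

  infixl 6 _-_

  _-_ : Pred L 0ℓ → L → Pred L 0ℓ
  (A - a) x = x ∈ A × x ≢ a

  remove-⊊ : ∀ {A a} → a ∈ A → A - a ⊊ A
  remove-⊊ a∈A = proj₁ , _ , a∈A , λ a∈ → proj₂ a∈ refl

  upper-bound-insert : ∀ {A a u} → a ≤ u → (∀ {x} → x ∈ A - a → x ≤ u) → ∀ {x} → x ∈ A → x ≤ u
  upper-bound-insert {a = a} a≤u ub {x} x∈A with x ≟ a
  ... | yes refl = a≤u
  ... | no x≢a = ub (x∈A , x≢a)

  isJoinIn-⊆ : ∀ {Q B C Y w} → B ⊆ C → C ⊆ Y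
    → IsJoinIn _≤_ Q B w → IsJoinIn _≤_ Q Y w → IsJoinIn _≤_ Q C w
  isJoinIn-⊆ B⊆C C⊆Y (_ , _ , _ , leastB) (Y⊆Q , w∈Q , boundY , _) =
    (λ c → Y⊆Q (C⊆Y c)) , w∈Q , (λ c → boundY (C⊆Y c)) ,
    λ u u∈Q ub → leastB u u∈Q (λ b → ub (B⊆C b))

  irredundant-⊆ : ∀ {Q A B w} → IrredundantJoin _≤_ Q A w → B ⊆ A → IsJoinIn _≤_ Q B w
    → IrredundantJoin _≤_ Q B w
  irredundant-⊆ (_ , irr) B⊆A JB =
    JB , λ B′ (B′⊆B , b , b∈B , b∉B′) → irr B′ ((λ x → B⊆A (B′⊆B x)) , b , B⊆A b∈B , b∉B′)

  irredundant-essential : ∀ {Q A w a} → IrredundantJoin _≤_ Q A w → a ∈ A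
    → ¬ (∀ u → u ∈ Q → (∀ {x} → x ∈ A - a → x ≤ u) → a ≤ u)
  irredundant-essential ((A⊆Q , w∈Q , bound , least) , irr) a∈A a≤ub =
    irr _ (remove-⊊ a∈A) ((λ x∈ → A⊆Q (proj₁ x∈)) , w∈Q , (λ x∈ → bound (proj₁ x∈)) ,
      λ u u∈Q ub → least u u∈Q (upper-bound-insert (a≤ub u u∈Q ub) ub))

  irredundant-antichain : ∀ {Q A w a c} → IrredundantJoin _≤_ Q A w
    → a ∈ A → c ∈ A → a ≤ c → a ≡ c
  irredundant-antichain ij a∈A c∈A a≤c = decidable-stable (_ ≟ _) λ a≢c →
    irredundant-essential ij a∈A λ u _ ub → ≤-trans a≤c (ub (c∈A , λ c≡a → a≢c (sym c≡a)))

  -- The finite combinatorics below is classical, and excluded middle is extracted from the data: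
  -- for a ∈ A the set (A - a) ∪ {a | Dec R} still has join w, because ¬ ¬ Dec R and ≤ is
  -- decidable, so canonicity puts a below one of its elements, which can only be a itself.
  canonical⇒excludedMiddle : Decidable _≤_ → ∀ {Q A w a} → IsCanonicalJoinRep _≤_ Q A w → a ∈ A
    → ExcludedMiddle 0ℓ
  canonical⇒excludedMiddle _≤?_ {Q} {A} {w} {a} (ij@((A⊆Q , w∈Q , bound , least) , _) , refines) a∈A {R}
    with refines B (irredundant-⊆ ij B⊆A B-join) a∈A
    where
    B : Pred L 0ℓ
    B x = x ∈ A - a ⊎ (x ≡ a × Dec R)

    B⊆A : B ⊆ A
    B⊆A (inj₁ x∈) = proj₁ x∈
    B⊆A (inj₂ (refl , _)) = a∈A

    B-join : IsJoinIn _≤_ Q B w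
    B-join = (λ x∈ → A⊆Q (B⊆A x∈)) , w∈Q , (λ x∈ → bound (B⊆A x∈)) ,
      λ u u∈Q ub → decidable-stable (w ≤? u) λ w≰u → ¬¬-excluded-middle λ r? →
        w≰u (least u u∈Q (upper-bound-insert (ub (inj₂ (refl , r?))) (λ x∈ → ub (inj₁ x∈))))
  ... | b , inj₁ (b∈A , b≢a) , a≤b = ⊥-elim (b≢a (sym (irredundant-antichain ij a∈A b∈A a≤b)))
  ... | _ , inj₂ (_ , r?) , _ = r?

  module _ (fin : Finite L) (em : ExcludedMiddle 0ℓ) where
    open FiniteClassical fin em using (⊊-wellFounded)

    ∃-irredundant-⊆ : ∀ {Q Y w} → IsJoinIn _≤_ Q Y w
      → ∃ λ C → C ⊆ Y × IrredundantJoin _≤_ Q C w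
    ∃-irredundant-⊆ {Q} {Y} {w} = go (⊊-wellFounded Y)
      where
      go : ∀ {Y} → Acc _⊊_ Y → IsJoinIn _≤_ Q Y w → ∃ λ C → C ⊆ Y × IrredundantJoin _≤_ Q C w
      go {Y} (acc rs) J with em {∃ λ a → a ∈ Y × IsJoinIn _≤_ Q (Y - a) w}
      ... | yes (a , a∈Y , J-a) =
        let C , C⊆Y-a , irrC = go (rs (remove-⊊ a∈Y)) J-a in C , (λ c → proj₁ (C⊆Y-a c)) , irrC
      ... | no ∄a = Y , (λ y → y) , J , λ B (B⊆Y , a , a∈Y , a∉B) JB →
        ∄a (a , a∈Y , isJoinIn-⊆ (λ b∈B → B⊆Y b∈B , λ b≡a → a∉B (subst B b≡a b∈B)) proj₁ JB J)

module FiniteLattice {L : Set} {_≤_ : Rel L 0ℓ} {_∨_ _∧_ : Op₂ L}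
  (isLattice : LS.IsLattice _≡_ _≤_ _∨_ _∧_) (fin : Finite L) where

  open LS.IsLattice isLattice
    renaming (refl to ≤-refl; trans to ≤-trans; antisym to ≤-antisym)

  lattice : Lattice 0ℓ 0ℓ 0ℓ
  lattice = record { Carrier = L; _≈_ = _≡_; _≤_ = _≤_; _∨_ = _∨_; _∧_ = _∧_; isLattice = isLattice }

  open import Relation.Binary.Lattice.Properties.JoinSemilattice (Lattice.joinSemilattice lattice)
    using (x≤y⇒x∨y≈y; ∨-comm; ≈-dec⇒≤-dec)
  open import Relation.Binary.Lattice.Properties.MeetSemilattice (Lattice.meetSemilattice lattice)
    using (y≤x⇒x∧y≈y)
  open import Relation.Binary.Construct.NonStrictToStrict _≡_ _≤_ using (<-trans; <-irrefl)

  _≟_ : DecidableEquality L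
  _≟_ = finite⇒≟ fin

  _≤?_ : Decidable _≤_
  _≤?_ = ≈-dec⇒≤-dec _≟_

  open SubposetJoins _≤_ ≤-trans _≟_

  infix 4 _<ₗ_ _⋖ₗ_

  _<ₗ_ : Rel L 0ℓ
  _<ₗ_ = _<_ _≤_

  _⋖ₗ_ : Rel L 0ℓ
  _⋖ₗ_ = _⋖_ _≤_

  y≤x⇒x∨y≡x : ∀ {x y} → y ≤ x → x ∨ y ≡ x
  y≤x⇒x∨y≡x {x} {y} y≤x = trans (∨-comm x y) (x≤y⇒x∨y≈y y≤x)

  ≰⇒∧< : ∀ {x z} → ¬ x ≤ z → z ∧ x <ₗ x
  ≰⇒∧< {x} {z} x≰z = x∧y≤y z x , λ z∧x≡x → x≰z (subst (_≤ z) z∧x≡x (x∧y≤x z x))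

  ≰⇒<∨ : ∀ {x z} → ¬ z ≤ x → x <ₗ z ∨ x
  ≰⇒<∨ {x} {z} z≰x = y≤x∨y z x , λ x≡z∨x → z≰x (subst (z ≤_) (sym x≡z∨x) (x≤x∨y z x))

  ⋀ : List L → L → L
  ⋀ xs x = foldr _∧_ x xs

  ⋀≤ : ∀ {xs x z} → z ∈ˡ xs → ⋀ xs x ≤ z
  ⋀≤ (here refl) = x∧y≤x _ _
  ⋀≤ (there z∈xs) = ≤-trans (x∧y≤y _ _) (⋀≤ z∈xs)

  ∃-least : L → ∃ λ b → ∀ z → b ≤ z
  ∃-least x = ⋀ elements x , λ z → ⋀≤ (subst (_∈ˡ elements) (from∘to z) (∈-map⁺ from (∈-allFin (to z))))
    where
    from = Inverse.from (proj₂ fin)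
    to = Inverse.to (proj₂ fin)
    from∘to = Inverse.strictlyInverseʳ (proj₂ fin)
    elements = map from (allFin (proj₁ fin))

  ⋖-join : ∀ {a y y′} → y ⋖ₗ a → y′ ⋖ₗ a → y ≢ y′ → y ∨ y′ ≡ a
  ⋖-join {a} {y} {y′} ((y≤a , y≢a) , y-max) ((y′≤a , _) , y′-max) y≢y′ =
    decidable-stable ((y ∨ y′) ≟ a) λ y∨y′≢a →
      y-max (y ∨ y′) (x≤x∨y y y′ , y≢y∨y′) (∨-least y≤a y′≤a , y∨y′≢a)
    where
    y≢y∨y′ : y ≢ y ∨ y′
    y≢y∨y′ y≡y∨y′ =
      y′-max y (subst (y′ ≤_) (sym y≡y∨y′) (y≤x∨y y y′) , λ y′≡y → y≢y′ (sym y′≡y)) (y≤a , y≢a)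

  module _ (em : ExcludedMiddle 0ℓ) where
    open FiniteClassical fin em using (strict⇒wellFounded)

    ∃-minimalₗ : (S : Pred L 0ℓ) → ∀ {x} → x ∈ S → ∃ λ m → m ∈ S × (∀ {y} → y ∈ S → ¬ y <ₗ m)
    ∃-minimalₗ = ∃-minimal em (strict⇒wellFounded (<-trans isPartialOrder) <-irrefl)

    ∃-maximalₗ : (S : Pred L 0ℓ) → ∀ {x} → x ∈ S → ∃ λ m → m ∈ S × (∀ {y} → y ∈ S → ¬ m <ₗ y)
    ∃-maximalₗ = ∃-minimal em (strict⇒wellFounded (flip (<-trans isPartialOrder)) (λ x≡y → <-irrefl (sym x≡y)))

    ∃-⋖-above : ∀ {x j} → x <ₗ j → ∃ λ m → x ≤ m × m ⋖ₗ j
    ∃-⋖-above {x} {j} x<j =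
      let m , (x≤m , m<j) , m-max = ∃-maximalₗ (λ z → x ≤ z × z <ₗ j) (≤-refl , x<j)
      in m , x≤m , m<j , λ z m<z z<j → m-max (≤-trans x≤m (proj₁ m<z) , z<j) m<z

    <-lowerCover : ∀ {j j* x} → IsJoinIrreducibleWithLowerCover _≤_ j j* → x <ₗ j → x ≤ j*
    <-lowerCover (_ , unique) x<j =
      let m , x≤m , m⋖j = ∃-⋖-above x<j in subst (_ ≤_) (unique m m⋖j) x≤m

    canonical⇒∃< : ∀ {A w a} → IsCanonicalJoinRep _≤_ U A w → a ∈ A → ∃ λ y → y <ₗ a
    canonical⇒∃< {a = a} (ij , _) a∈A with em {∃ λ y → y <ₗ a}
    ... | yes y<a = y<a
    ... | no ∄y = ⊥-elim (irredundant-essential ij a∈A λ u _ _ →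
                    decidable-stable (a ≤? u) λ a≰u → ∄y (_ , ≰⇒∧< a≰u))

    canonical-⋖-unique : ∀ {A w a y y′} → IsCanonicalJoinRep _≤_ U A w → a ∈ A
      → y ⋖ₗ a → y′ ⋖ₗ a → y ≡ y′
    canonical-⋖-unique {A} {w} {a} {y} {y′} (ij@((_ , _ , bound , least) , _) , refines) a∈A
      y⋖a@((y≤a , y≢a) , _) y′⋖a@((y′≤a , y′≢a) , _) =
      decidable-stable (y ≟ y′) λ y≢y′ →
        let C , C⊆A′ , irrC = ∃-irredundant-⊆ fin em (A′-join (⋖-join y⋖a y′⋖a y≢y′))
            _ , c∈C , a≤c = refines C irrC a∈A
        in a-not-below (C⊆A′ c∈C) a≤c
      where
      A′ : Pred L 0ℓ
      A′ x = x ∈ A - a ⊎ (x ≡ y ⊎ x ≡ y′)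

      A′-bound : ∀ {x} → x ∈ A′ → x ≤ w
      A′-bound (inj₁ (x∈A , _)) = bound x∈A
      A′-bound (inj₂ (inj₁ refl)) = ≤-trans y≤a (bound a∈A)
      A′-bound (inj₂ (inj₂ refl)) = ≤-trans y′≤a (bound a∈A)

      A′-join : y ∨ y′ ≡ a → IsJoinIn _≤_ U A′ w
      A′-join y∨y′≡a = (λ _ → tt) , tt , A′-bound , λ u _ ub → least u tt (upper-bound-insert
        (subst (_≤ u) y∨y′≡a (∨-least (ub (inj₂ (inj₁ refl))) (ub (inj₂ (inj₂ refl)))))
        (λ x∈ → ub (inj₁ x∈)))

      a-not-below : ∀ {c} → c ∈ A′ → ¬ a ≤ c
      a-not-below (inj₁ (c∈A , c≢a)) a≤c = c≢a (sym (irredundant-antichain ij a∈A c∈A a≤c))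
      a-not-below (inj₂ (inj₁ refl)) a≤y = y≢a (≤-antisym y≤a a≤y)
      a-not-below (inj₂ (inj₂ refl)) a≤y′ = y′≢a (≤-antisym y′≤a a≤y′)

    canonical⇒joinIrreducible : ∀ {A w a} → IsCanonicalJoinRep _≤_ U A w → a ∈ A
      → ∃ (IsJoinIrreducibleWithLowerCover _≤_ a)
    canonical⇒joinIrreducible cj a∈A =
      let _ , y<a = canonical⇒∃< cj a∈A
          a* , _ , a*⋖a = ∃-⋖-above y<a
      in a* , a*⋖a , λ y y⋖a → canonical-⋖-unique cj a∈A y⋖a a*⋖a

  module Congruence {Θ : Rel L 0ℓ} (isCongruence : IsLatticeCongruence _∨_ _∧_ Θ) where
    open IsLatticeCongruence isCongruence using (∨-compat; ∧-compat)
    open IsEquivalence (IsLatticeCongruence.isEquivalence isCongruence) renaming (refl to Θ-refl; sym to Θ-sym; trans to Θ-trans)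

    P : Pred L 0ℓ
    P = PiDownImage _≤_ Θ

    π↓ : L → L → Set
    π↓ = IsPiDown _≤_ Θ

    Θ-∧ : ∀ {x y z} → x ≤ y → Θ y z → Θ x (z ∧ x)
    Θ-∧ {x} {y} {z} x≤y θ = subst (λ t → Θ t (z ∧ x)) (y≤x⇒x∧y≈y x≤y) (∧-compat x θ)

    Θ-∨ : ∀ {x y z} → x ≤ y → Θ x z → Θ y (z ∨ y)
    Θ-∨ {x} {y} {z} x≤y θ = subst (λ t → Θ t (z ∨ y)) (x≤y⇒x∨y≈y x≤y) (∨-compat y θ)

    image-fixed : ∀ {p} → p ∈ P → π↓ p p
    image-fixed (_ , θxp , least) = Θ-refl , λ z θpz → least z (Θ-trans θxp θpz)

    π↓-mono : ∀ {x y px py} → x ≤ y → π↓ x px → π↓ y py → px ≤ py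
    π↓-mono x≤y (_ , least-x) (θy , _) = ≤-trans (least-x _ (Θ-∧ x≤y θy)) (x∧y≤x _ _)

    isJoinIn-U⇒P : ∀ {B w} → B ⊆ P → IsJoinIn _≤_ U B w → IsJoinIn _≤_ P B w
    isJoinIn-U⇒P {B} {w} B⊆P (_ , _ , bound , least) =
      B⊆P , (w , Θ-refl , w-least) , bound , λ u _ ub → least u tt ub
      where
      w-least : ∀ z → Θ w z → w ≤ z
      w-least z θwz = least z tt λ b∈B →
        ≤-trans (proj₂ (image-fixed (B⊆P b∈B)) _ (Θ-∧ (bound b∈B) θwz)) (x∧y≤x z _)

    π↓-image : Pred L 0ℓ → Pred L 0ℓ
    π↓-image B y = ∃ λ b → b ∈ B × π↓ b y

    module _ (em : ExcludedMiddle 0ℓ) where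

      ∃-π↓ : ∀ x → ∃ (π↓ x)
      ∃-π↓ x =
        let m , θxm , m-min = ∃-minimalₗ em (Θ x) Θ-refl
        in m , θxm , λ z θxz → decidable-stable (m ≤? z) λ m≰z →
             m-min (Θ-trans θxm (Θ-∧ ≤-refl (Θ-trans (Θ-sym θxm) θxz))) (≰⇒∧< m≰z)

      ∃-π↑ : ∀ x → ∃ λ M → Θ x M × (∀ z → Θ x z → z ≤ M)
      ∃-π↑ x =
        let M , θxM , M-max = ∃-maximalₗ em (Θ x) Θ-refl
        in M , θxM , λ z θxz → decidable-stable (z ≤? M) λ z≰M →
             M-max (Θ-trans θxM (Θ-∨ ≤-refl (Θ-trans (Θ-sym θxM) θxz))) (≰⇒<∨ z≰M)

      isJoinIn-P⇒U : ∀ {B w} → B ⊆ P → IsJoinIn _≤_ P B w → IsJoinIn _≤_ U B w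
      isJoinIn-P⇒U B⊆P (_ , _ , bound , least) = (λ _ → tt) , tt , bound , λ u _ ub →
        let pu , π↓u = ∃-π↓ u
        in ≤-trans (least pu (u , π↓u) (λ b∈B → π↓-mono (ub b∈B) (image-fixed (B⊆P b∈B)) π↓u))
                   (proj₂ π↓u u Θ-refl)

      irredundant-P⇒U : ∀ {B w} → IrredundantJoin _≤_ P B w → IrredundantJoin _≤_ U B w
      irredundant-P⇒U (J@(B⊆P , _) , irr) =
        isJoinIn-P⇒U B⊆P J , λ B′ B′⊊B J′ → irr B′ B′⊊B (isJoinIn-U⇒P (λ b → B⊆P (proj₁ B′⊊B b)) J′)

      -- With c = u ∧ w and M the top of its class: b ≤ b ∨ c ≡Θ π↓ b ∨ c = c, so w ≤ M,
      -- whence w ≡Θ c and w = π↓ w ≤ c.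
      π↓-image-join : ∀ {B w} → w ∈ P → IsJoinIn _≤_ U B w → IsJoinIn _≤_ U (π↓-image B) w
      π↓-image-join {B} {w} w∈P (_ , _ , bound , least) =
        (λ _ → tt) , tt , (λ (b , b∈B , _ , b-min) → ≤-trans (b-min b Θ-refl) (bound b∈B)) , w-least
        where
        w-least : ∀ u → u ∈ U → (∀ {y} → y ∈ π↓-image B → y ≤ u) → w ≤ u
        w-least u _ ub =
          let M , θcM , M-max = ∃-π↑ c

              b≤M : ∀ {b} → b ∈ B → b ≤ M
              b≤M {b} b∈B =
                let pb , π↓b@(θb , b-min) = ∃-π↓ b
                    pb≤c = ∧-greatest (ub (b , b∈B , π↓b)) (≤-trans (b-min b Θ-refl) (bound b∈B))
                in ≤-trans (x≤x∨y b c) (M-max _ (Θ-∨ pb≤c (Θ-sym θb)))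
          in ≤-trans (proj₂ (image-fixed w∈P) _ (Θ-∧ (least M tt b≤M) (Θ-sym θcM)))
                     (≤-trans (x∧y≤x c w) (x∧y≤x u w))
          where
          c = u ∧ w

      canonical-P-refines : ∀ {A B w} → IsCanonicalJoinRep _≤_ P A w → IrredundantJoin _≤_ U B w
        → Refines _≤_ U A B
      canonical-P-refines (((_ , w∈P , _) , _) , refines) (JB , _) a∈A =
        let C , C⊆image , irrC = ∃-irredundant-⊆ fin em
              (isJoinIn-U⇒P (λ (b , _ , π↓b) → b , π↓b) (π↓-image-join w∈P JB))
            _ , c∈C , a≤c = refines C irrC a∈A
            b , b∈B , _ , b-min = C⊆image c∈C
        in b , b∈B , ≤-trans a≤c (b-min b Θ-refl)

      uncontracted⇒fixed : ∀ {j} → j ∈ UncontractedJoinIrreducible _≤_ Θ → π↓ j j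
      uncontracted⇒fixed {j} (j* , ji@(((j*≤j , _) , _) , _) , ¬θ) = Θ-refl , λ z θjz →
        decidable-stable (j ≤? z) λ j≰z → ¬θ (Θ-sym (subst (Θ j*) (y≤x⇒x∨y≡x j*≤j)
          (Θ-∨ (<-lowerCover em ji (≰⇒∧< j≰z)) (Θ-sym (Θ-∧ ≤-refl θjz)))))

    -- An empty A yields no excluded middle; then w is the least element of P, hence of L.
    canonical-P⇒isJoinIn-U : ∀ {A w} → A ⊆ P → IsCanonicalJoinRep _≤_ P A w → IsJoinIn _≤_ U A w
    canonical-P⇒isJoinIn-U {A} {w} A⊆P cj@((J@(_ , _ , bound , least) , _) , _) =
      (λ _ → tt) , tt , bound , λ u _ ub → decidable-stable (w ≤? u) λ w≰u →
        ¬¬-excluded-middle {A = ∃ A} λ where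
          (yes (_ , a∈A)) →
            let (_ , _ , _ , leastU) = isJoinIn-P⇒U (canonical⇒excludedMiddle _≤?_ cj a∈A) A⊆P J
            in w≰u (leastU u tt ub)
          (no ∄a) →
            let b , b-least = ∃-least u
            in w≰u (≤-trans (least b (b , Θ-refl , λ z _ → b-least z) (λ a∈A → ⊥-elim (∄a (_ , a∈A))))
                            (b-least u))

    canonical-P⇒U : ∀ {A w} → A ⊆ P → IsCanonicalJoinRep _≤_ P A w → IsCanonicalJoinRep _≤_ U A w
    canonical-P⇒U A⊆P cj@((_ , irr) , _) =
      (canonical-P⇒isJoinIn-U A⊆P cj ,
       λ B B⊊A JB → irr B B⊊A (isJoinIn-U⇒P (λ b → A⊆P (proj₁ B⊊A b)) JB)) ,
      λ B irrB a∈A → canonical-P-refines (canonical⇒excludedMiddle _≤?_ cj a∈A) cj irrB a∈A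

    canonical-⊆P⇒uncontracted : ∀ {A w} → IsCanonicalJoinRep _≤_ U A w → A ⊆ P
      → A ⊆ UncontractedJoinIrreducible _≤_ Θ
    canonical-⊆P⇒uncontracted cj A⊆P a∈A =
      let a* , ji@(((a*≤a , a*≢a) , _) , _) =
            canonical⇒joinIrreducible (canonical⇒excludedMiddle _≤?_ cj a∈A) cj a∈A
      in a* , ji , λ θ → a*≢a (≤-antisym a*≤a (proj₂ (image-fixed (A⊆P a∈A)) _ θ))

    canonical-U⇒P : ∀ {A w} → A ⊆ UncontractedJoinIrreducible _≤_ Θ → IsCanonicalJoinRep _≤_ U A w
      → A ⊆ P × IsCanonicalJoinRep _≤_ P A w
    canonical-U⇒P {A} A⊆J cj@((J , irr) , refines) =
      A⊆P ,
      (isJoinIn-U⇒P A⊆P J ,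
       λ B B⊊A@(_ , _ , a∈A , _) JB → irr B B⊊A (isJoinIn-P⇒U (em a∈A) (proj₁ JB) JB)) ,
      λ B irrB a∈A → refines B (irredundant-P⇒U (em a∈A) irrB) a∈A
      where
      em : ∀ {a} → a ∈ A → ExcludedMiddle 0ℓ
      em = canonical⇒excludedMiddle _≤?_ cj

      A⊆P : A ⊆ P
      A⊆P a∈A = _ , uncontracted⇒fixed (em a∈A) (A⊆J a∈A)

corollary4p3 : {L : Set} (_≤_ : Rel L 0ℓ) (_∨_ _∧_ : Op₂ L)
    → LS.IsLattice _≡_ _≤_ _∨_ _∧_
    → Finite L
    → JoinSemidistributive _∨_ _∧_
    → (Θ : Rel L 0ℓ) → IsLatticeCongruence _∨_ _∧_ Θ
    → (A : Pred L 0ℓ)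
    → ((A ⊆ PiDownImage _≤_ Θ) × CJCFace _≤_ (PiDownImage _≤_ Θ) A)
      ⇔ (CJCFace _≤_ U A × (A ⊆ UncontractedJoinIrreducible _≤_ Θ))
corollary4p3 _≤_ _∨_ _∧_ isLattice fin _ Θ isCongruence A = mk⇔
  (λ (A⊆P , w , cj) →
    let cjU = canonical-P⇒U A⊆P cj in (w , cjU) , canonical-⊆P⇒uncontracted cjU A⊆P)
  (λ ((w , cj) , A⊆J) →
    let A⊆P , cjP = canonical-U⇒P A⊆J cj in A⊆P , w , cjP)
  where
  open FiniteLattice isLattice fin
  open Congruence isCongruence
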